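{- Let $w\in\mathfrak{S}_N$. If $w$ has an $N$-occurrence of $4321$, then $|\mathrm{newrep}(w)|<[321;3412]_N(w)$.
   Context: Permutations are written in one-line notation; $s_i$ is the simple reflection interchanging $i$ and $i+1$; $\mathrm{supp}(u)$ is the set of distinct simple reflections appearing in a reduced decomposition of $u$ (independent of the choice). An occurrence of a pattern $p\in\mathfrak{S}_k$ in $w$ is a subsequence $w(i_1)\cdots w(i_k)$, $i_1<\cdots<i_k$, in the same relative order as $p$; it is an $N$-occurrence if its largest value is $N$. $[321;3412]_N(w)$ is the number of $N$-occurrences of $321$ in $w$ plus the number of $N$-occurrences of $3412$ in $w$. For $w\in\mathfrak{S}_N$, $\overline{w}\in\mathfrak{S}_{N-1}$ is obtained by deleting the letter $N$ from the one-line notation of $w$, and $\mathrm{newrep}(w)=\{k:\ s_k\in\mathrm{supp}(\overline{w}),\ w^{ -1}(N)\le k\}$. -}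

module Defs where

open import Data.Nat using (ℕ; zero; suc; _+_; _∸_; _≤_; _<_; _<ᵇ_; _≤ᵇ_; _≡ᵇ_)
open import Data.Bool using (Bool; true; false; _∧_; if_then_else_)
open import Data.List using (List; []; _∷_; length; map; upTo; filter; foldl)
open import Data.Nat.ListAction using (sum)
open import Data.Bool.ListAction using (any)
open import Data.List.Relation.Binary.Permutation.Propositional using (_↭_)
open import Data.Product using (Σ; _×_; ∃-syntax)
open import Relation.Binary.PropositionalEquality using (_≡_)
open import Relation.Nullary.Decidable using (does)
open import Data.Nat using (_≟_)

-- Permutations are lists in one-line notation with values 1..n.
-- w ∈ 𝔖_n  iff  w is a rearrangement of [1, 2, ..., n].
IsPerm : ℕ → List ℕ → Set
IsPerm n w = w ↭ map suc (upTo n)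

identity : ℕ → List ℕ
identity n = map suc (upTo n)

-- the entry at (0-indexed) position p; default 0 out of range
at : List ℕ → ℕ → ℕ
at []       _       = 0
at (x ∷ xs) zero    = x
at (x ∷ xs) (suc p) = at xs p

-- right multiplication by s_k (k ≥ 1): swaps the entries at 1-indexed positions k, k+1
swapAt : ℕ → List ℕ → List ℕ
swapAt zero          xs           = xs
swapAt (suc zero)    (x ∷ y ∷ xs) = y ∷ x ∷ xs
swapAt (suc zero)    xs           = xs
swapAt (suc (suc k)) []           = []
swapAt (suc (suc k)) (x ∷ xs)     = x ∷ swapAt (suc k) xs

-- the product s_{a₁} s_{a₂} ⋯ s_{aₗ} in 𝔖_n, in one-line notation
wordProd : ℕ → List ℕ → List ℕ
wordProd n ρ = foldl (λ u k → swapAt k u) (identity n) ρ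

data ValidLetters (n : ℕ) : List ℕ → Set where
  []  : ValidLetters n []
  _∷_ : ∀ {k ρ} → (1 ≤ k × suc k ≤ n) → ValidLetters n ρ → ValidLetters n (k ∷ ρ)

IsReducedWord : ℕ → List ℕ → List ℕ → Set
IsReducedWord n u ρ =
  ValidLetters n ρ × wordProd n ρ ≡ u ×
  (∀ ρ′ → ValidLetters n ρ′ → wordProd n ρ′ ≡ u → length ρ ≤ length ρ′)

inSupp : ℕ → List ℕ → Bool
inSupp k ρ = any (λ a → a ≡ᵇ k) ρ

deleteLetter : ℕ → List ℕ → List ℕ
deleteLetter N w = filter (λ x → Relation.Nullary.Decidable.¬? (x ≟ N)) w

-- |newrep(w)| where ρ is a reduced decomposition of w̄ and q = w⁻¹(N) (1-indexed)
newrepCount : ℕ → ℕ → List ℕ → ℕ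
newrepCount N q ρ =
  sum (map (λ k → if inSupp k ρ ∧ (q ≤ᵇ k) then 1 else 0) (upTo N))

ind : Bool → ℕ
ind b = if b then 1 else 0

count321N : ℕ → List ℕ → ℕ
count321N N w =
  sum (map (λ i → sum (map (λ j → sum (map (λ k →
    ind ((i <ᵇ j) ∧ (j <ᵇ k) ∧ (at w j <ᵇ at w i) ∧ (at w k <ᵇ at w j)
         ∧ (at w i ≡ᵇ N)))
    (upTo N))) (upTo N))) (upTo N))

count3412N : ℕ → List ℕ → ℕ
count3412N N w =
  sum (map (λ a → sum (map (λ b → sum (map (λ c → sum (map (λ d →
    ind ((a <ᵇ b) ∧ (b <ᵇ c) ∧ (c <ᵇ d)
         ∧ (at w c <ᵇ at w d) ∧ (at w d <ᵇ at w a) ∧ (at w a <ᵇ at w b)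
         ∧ (at w b ≡ᵇ N)))
    (upTo N))) (upTo N))) (upTo N))) (upTo N))

count321-3412N : ℕ → List ℕ → ℕ
count321-3412N N w = count321N N w + count3412N N w

Has4321N : ℕ → List ℕ → Set
Has4321N N w = ∃[ a ] ∃[ b ] ∃[ c ] ∃[ d ]
  (a < b × b < c × c < d × d < N ×
   at w b < at w a × at w c < at w b × at w d < at w c × at w a ≡ N)

-- A reduced word of w̄ has exactly as many letters as w̄ has inversions, so every letter creates an inversion;
-- swapping an ascent moves its larger entry left and its smaller entry right, so an inversion between the
-- first k entries and the rest, once created, survives. Hence s_k ∈ supp(w̄) yields such an inversion of w̄,
-- and for k ≥ w⁻¹(N) it lifts to an inversion (i, j) of w with i ≤ k < j avoiding the letter N.
-- For each such k let d be the position of the minimum to the right of k and c the last position ≤ k, other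
-- than that of N, whose entry exceeds w(d). Then (N, w(c), w(d)) is a 321 when c lies right of N, and
-- (w(c), N, w(k), w(d)) is a 3412 otherwise; k ↦ this occurrence is injective and never hits the 321 formed
-- by the first three letters of a 4321, whose last letter is not the minimum to its right.
module Submission where

open import Defs
open import Data.Bool using (Bool; true; false; T; _∧_)
open import Data.Bool.Properties using (T-∧)
open import Data.Empty using (⊥; ⊥-elim)
open import Data.List using (List; []; _∷_; _++_; [_]; length; map; upTo; foldl; filter; filterᵇ; concatMap)
open import Data.List.Extrema using (argmin; argmin-all; f[argmin]≤f[xs])
open import Data.List.Membership.Propositional using (_∈_)
open import Data.List.Membership.Propositional.Properties
  using (∈-map⁺; ∈-map⁻; ∈-concat⁺′; ∈-∃++; ∈-++⁺ˡ; ∈-++⁺ʳ; ∈-++⁻;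
         ∈-upTo⁺; ∈-upTo⁻; ∈-filter⁺; ∈-filter⁻)
open import Data.List.Properties
  using (length-++; length-map; length-upTo; map-cong; foldl-++; filter-none; filter-accept; filter-reject; filter-notAll)
open import Data.List.Relation.Binary.Permutation.Propositional using (_↭_; prep; swap; ↭-refl; ↭-sym; ↭-trans; ↭⇒↭ₛ)
open import Data.List.Relation.Binary.Permutation.Propositional.Properties using (↭-length; ∈-resp-↭; filter-↭)
import Data.List.Relation.Binary.Permutation.Setoid.Properties as PermSetoid
open import Data.List.Relation.Binary.Pointwise using (Pointwise-≡⇒≡)
open import Data.List.Relation.Binary.Subset.Propositional using (_⊆_)
open import Data.List.Relation.Unary.All as All using (All; []; _∷_)
open import Data.List.Relation.Unary.AllPairs using ([]; _∷_)
open import Data.List.Relation.Unary.Any as Any using (here; there)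
open import Data.List.Relation.Unary.Any.Properties using (any⁻)
open import Data.List.Relation.Unary.Linked using (Linked; []; [-]; _∷_)
import Data.List.Relation.Unary.Linked.Properties as Linked
open import Data.List.Relation.Unary.Sorted.TotalOrder.Properties using (↗↭↗⇒≋)
open import Data.List.Relation.Unary.Unique.Propositional using (Unique)
import Data.List.Relation.Unary.Unique.Propositional.Properties as Unique
open import Data.Nat using (ℕ; zero; suc; _+_; _∸_; _≤_; _<_; _<ᵇ_; _≤ᵇ_; _≡ᵇ_; z≤n; s≤s; _≟_; _<?_)
open import Data.Nat.ListAction using (sum)
open import Data.Nat.Properties
open import Data.Nat.Tactic.RingSolver using (solve-∀)
open import Data.Product as Product using (_×_; _,_; proj₁; proj₂; ∃-syntax)
open import Data.Sum using (_⊎_; inj₁; inj₂; [_,_]′)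
open import Data.Sum.Properties using (inj₁-injective; inj₂-injective)
open import Function using (_∘_; Equivalence)
open import Relation.Binary.Definitions using (Tri; tri<; tri≈; tri>)
open import Relation.Binary.PropositionalEquality hiding ([_])
open import Relation.Nullary using (¬_; Dec; yes; no; contradiction)
open import Relation.Nullary.Decidable using (T?; ¬?; _×-dec_)
open import Relation.Unary using (Decidable)

private variable
  A B : Set

infixr 4 _∧ᵀ_
_∧ᵀ_ : ∀ {a b} → T a → T b → T (a ∧ b)
p ∧ᵀ q = Equivalence.from T-∧ (p , q)

ind-true : ∀ {b} → T b → ind b ≡ 1
ind-true {true} _ = refl

ind-false : ∀ {b} → ¬ T b → ind b ≡ 0
ind-false {false} _ = refl
ind-false {true} ¬t = contradiction _ ¬t

ind≤1 : ∀ b → ind b ≤ 1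
ind≤1 true = ≤-refl
ind≤1 false = z≤n

ind-positive : ∀ {b} → 0 < ind b → T b
ind-positive {true} _ = _

length-filterᵇ-∷ : ∀ (b : A → Bool) x xs →
  length (filterᵇ b (x ∷ xs)) ≡ ind (b x) + length (filterᵇ b xs)
length-filterᵇ-∷ b x xs with b x
... | true = refl
... | false = refl

sum-ind≡length-filterᵇ : ∀ (b : A → Bool) xs → sum (map (λ x → ind (b x)) xs) ≡ length (filterᵇ b xs)
sum-ind≡length-filterᵇ b [] = refl
sum-ind≡length-filterᵇ b (x ∷ xs) =
  trans (cong (ind (b x) +_) (sum-ind≡length-filterᵇ b xs)) (sym (length-filterᵇ-∷ b x xs))

length-concatMap : ∀ (f : A → List B) xs → length (concatMap f xs) ≡ sum (map (length ∘ f) xs)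
length-concatMap f [] = refl
length-concatMap f (x ∷ xs) = trans (length-++ (f x)) (cong (length (f x) +_) (length-concatMap f xs))

∈-concatMap⁺ : ∀ (f : A → List B) {xs a b} → a ∈ xs → b ∈ f a → b ∈ concatMap f xs
∈-concatMap⁺ f a∈xs b∈fa = ∈-concat⁺′ b∈fa (∈-map⁺ f a∈xs)

∈-++-∷-≢ : ∀ {x z : A} l r → z ∈ l ++ x ∷ r → z ≢ x → z ∈ l ++ r
∈-++-∷-≢ l r z∈ z≢x with ∈-++⁻ l z∈
... | inj₁ z∈l = ∈-++⁺ˡ z∈l
... | inj₂ (here z≡x) = contradiction z≡x z≢x
... | inj₂ (there z∈r) = ∈-++⁺ʳ l z∈r

Unique-⊆⇒length≤ : ∀ {xs ys : List A} → Unique xs → xs ⊆ ys → length xs ≤ length ys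
Unique-⊆⇒length≤ {xs = []} _ _ = z≤n
Unique-⊆⇒length≤ {xs = x ∷ xs} (x∉xs ∷ xs-unique) xs⊆ys with ∈-∃++ (xs⊆ys (here refl))
... | l , r , refl = begin
  suc (length xs)            ≤⟨ s≤s (Unique-⊆⇒length≤ xs-unique xs⊆l++r) ⟩
  suc (length (l ++ r))      ≡⟨ cong suc (length-++ l) ⟩
  suc (length l + length r)  ≡⟨ +-suc (length l) (length r) ⟨
  length l + length (x ∷ r)  ≡⟨ length-++ l ⟨
  length (l ++ x ∷ r)        ∎
  where
  open ≤-Reasoning
  xs⊆l++r : xs ⊆ l ++ r
  xs⊆l++r z∈xs = ∈-++-∷-≢ l r (xs⊆ys (there z∈xs)) (λ z≡x → All.lookup x∉xs z∈xs (sym z≡x))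

Unique-map⁺-on : ∀ (f : A → B) {xs} → (∀ {x y} → x ∈ xs → y ∈ xs → f x ≡ f y → x ≡ y) →
  Unique xs → Unique (map f xs)
Unique-map⁺-on f {[]} _ [] = []
Unique-map⁺-on f {x ∷ xs} f-inj (x∉xs ∷ xs-unique) =
  All.tabulate fx∉ ∷ Unique-map⁺-on f (λ x∈ y∈ → f-inj (there x∈) (there y∈)) xs-unique
  where
  fx∉ : ∀ {z} → z ∈ map f xs → f x ≢ z
  fx∉ z∈ fx≡z with ∈-map⁻ f z∈
  ... | y , y∈xs , refl = All.lookup x∉xs y∈xs (f-inj (here refl) (there y∈xs) fx≡z)

at-out-of-range : ∀ v i → length v ≤ i → at v i ≡ 0
at-out-of-range [] i _ = refl
at-out-of-range (x ∷ v) (suc i) (s≤s le) = at-out-of-range v i le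

at-∈ : ∀ v {i} → i < length v → at v i ∈ v
at-∈ (x ∷ v) {zero} _ = here refl
at-∈ (x ∷ v) {suc i} (s≤s i<) = there (at-∈ v i<)

Unique-at-injective : ∀ {v i j} → Unique v → i < length v → j < length v → at v i ≡ at v j → i ≡ j
Unique-at-injective {x ∷ v} {zero} {zero} _ _ _ _ = refl
Unique-at-injective {x ∷ v} {zero} {suc j} (x∉v ∷ _) _ (s≤s j<) x≡ = contradiction x≡ (All.lookup x∉v (at-∈ v j<))
Unique-at-injective {x ∷ v} {suc i} {zero} (x∉v ∷ _) (s≤s i<) _ ≡x = contradiction (sym ≡x) (All.lookup x∉v (at-∈ v i<))
Unique-at-injective {x ∷ v} {suc i} {suc j} (_ ∷ v-unique) (s≤s i<) (s≤s j<) eq =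
  cong suc (Unique-at-injective v-unique i< j< eq)

identity-sorted : ∀ n → Linked _≤_ (identity n)
identity-sorted n = Linked.map⁺ (Linked.applyUpTo⁺₂ (λ i → i) n (λ i → n≤1+n (suc i)))

perm-length : ∀ {n v} → IsPerm n v → length v ≡ n
perm-length {n} v-perm = trans (↭-length v-perm) (trans (length-map suc (upTo n)) (length-upTo n))

perm-Unique : ∀ {n v} → IsPerm n v → Unique v
perm-Unique {n} v-perm =
  PermSetoid.Unique-resp-↭ (setoid ℕ) (↭⇒↭ₛ (↭-sym v-perm)) (Unique.map⁺ suc-injective (Unique.upTo⁺ n))

perm-at-injective : ∀ {n v i j} → IsPerm n v → i < n → j < n → at v i ≡ at v j → i ≡ j
perm-at-injective v-perm i<n j<n =
  Unique-at-injective (perm-Unique v-perm) (subst (_ <_) (sym (perm-length v-perm)) i<n)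
    (subst (_ <_) (sym (perm-length v-perm)) j<n)

perm-at-≤ : ∀ {n v} → IsPerm n v → ∀ i → at v i ≤ n
perm-at-≤ {n} {v} v-perm i with i <? length v
... | no i≮ = subst (_≤ n) (sym (at-out-of-range v i (≮⇒≥ i≮))) z≤n
... | yes i< with ∈-map⁻ suc (∈-resp-↭ v-perm (at-∈ v i<))
...   | k , k∈ , v[i]≡1+k = subst (_≤ n) (sym v[i]≡1+k) (∈-upTo⁻ k∈)

perm-at-<-max : ∀ {n v p x} → IsPerm n v → p < n → at v p ≡ n → x ≢ p → at v x < n
perm-at-<-max {n} {v} {p} {x} v-perm p<n v[p]≡n x≢p with x <? n
... | yes x<n = ≤∧≢⇒< (perm-at-≤ v-perm x)
  (λ v[x]≡n → x≢p (perm-at-injective v-perm x<n p<n (trans v[x]≡n (sym v[p]≡n))))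
... | no x≮n = subst (_< n) (sym (at-out-of-range v x (subst (_≤ x) (sym (perm-length v-perm)) (≮⇒≥ x≮n))))
  (≤-<-trans z≤n p<n)

-- Adjacent transpositions

applyWord : List ℕ → List ℕ → List ℕ
applyWord = foldl (λ u k → swapAt k u)

swapAt-↭ : ∀ k v → swapAt k v ↭ v
swapAt-↭ zero v = ↭-refl
swapAt-↭ (suc zero) [] = ↭-refl
swapAt-↭ (suc zero) (x ∷ []) = ↭-refl
swapAt-↭ (suc zero) (x ∷ y ∷ v) = swap y x ↭-refl
swapAt-↭ (suc (suc k)) [] = ↭-refl
swapAt-↭ (suc (suc k)) (x ∷ v) = prep x (swapAt-↭ (suc k) v)

length-swapAt : ∀ k v → length (swapAt k v) ≡ length v
length-swapAt k v = ↭-length (swapAt-↭ k v)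

swapAt-involutive : ∀ k v → swapAt k (swapAt k v) ≡ v
swapAt-involutive zero v = refl
swapAt-involutive (suc zero) [] = refl
swapAt-involutive (suc zero) (x ∷ []) = refl
swapAt-involutive (suc zero) (x ∷ y ∷ v) = refl
swapAt-involutive (suc (suc k)) [] = refl
swapAt-involutive (suc (suc k)) (x ∷ v) = cong (x ∷_) (swapAt-involutive (suc k) v)

swapAt-out-of-range : ∀ m v → length v ≤ suc m → swapAt (suc m) v ≡ v
swapAt-out-of-range zero [] _ = refl
swapAt-out-of-range zero (x ∷ []) _ = refl
swapAt-out-of-range zero (x ∷ y ∷ v) (s≤s ())
swapAt-out-of-range (suc m) [] _ = refl
swapAt-out-of-range (suc m) (x ∷ v) (s≤s le) = cong (x ∷_) (swapAt-out-of-range m v le)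

at-swapAt-left : ∀ m v → suc m < length v → at (swapAt (suc m) v) m ≡ at v (suc m)
at-swapAt-left zero (x ∷ y ∷ v) _ = refl
at-swapAt-left zero (x ∷ []) (s≤s ())
at-swapAt-left (suc m) (x ∷ v) (s≤s lt) = at-swapAt-left m v lt

at-swapAt-right : ∀ m v → suc m < length v → at (swapAt (suc m) v) (suc m) ≡ at v m
at-swapAt-right zero (x ∷ y ∷ v) _ = refl
at-swapAt-right zero (x ∷ []) (s≤s ())
at-swapAt-right (suc m) (x ∷ v) (s≤s lt) = at-swapAt-right m v lt

at-swapAt-other : ∀ m v x → x ≢ m → x ≢ suc m → at (swapAt (suc m) v) x ≡ at v x
at-swapAt-other zero [] x _ _ = refl
at-swapAt-other zero (y ∷ []) x _ _ = refl
at-swapAt-other zero (y ∷ z ∷ v) zero x≢0 _ = contradiction refl x≢0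
at-swapAt-other zero (y ∷ z ∷ v) (suc zero) _ x≢1 = contradiction refl x≢1
at-swapAt-other zero (y ∷ z ∷ v) (suc (suc x)) _ _ = refl
at-swapAt-other (suc m) [] x _ _ = refl
at-swapAt-other (suc m) (y ∷ v) zero _ _ = refl
at-swapAt-other (suc m) (y ∷ v) (suc x) x≢m x≢m+1 =
  at-swapAt-other m v x (x≢m ∘ cong suc) (x≢m+1 ∘ cong suc)

applyWord-↭ : ∀ v σ → applyWord v σ ↭ v
applyWord-↭ v [] = ↭-refl
applyWord-↭ v (k ∷ σ) = ↭-trans (applyWord-↭ (swapAt k v) σ) (swapAt-↭ k v)

ascent-in-range : ∀ m v → at v m < at v (suc m) → suc m < length v
ascent-in-range m v ascent with suc m <? length v
... | yes lt = lt
... | no out = contradiction (subst (at v m <_) (at-out-of-range v (suc m) (≮⇒≥ out)) ascent) n≮0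

-- Inversions and reduced words

inversions : List ℕ → ℕ
inversions [] = 0
inversions (x ∷ xs) = length (filterᵇ (_<ᵇ x) xs) + inversions xs

length-filter-<ᵇ-↭ : ∀ x {xs ys} → xs ↭ ys → length (filterᵇ (_<ᵇ x) xs) ≡ length (filterᵇ (_<ᵇ x) ys)
length-filter-<ᵇ-↭ x xs↭ys = ↭-length (filter-↭ (T? ∘ (_<ᵇ x)) xs↭ys)

inversions-swap-head : ∀ x y zs →
  inversions (x ∷ y ∷ zs) + ind (x <ᵇ y) ≡ inversions (y ∷ x ∷ zs) + ind (y <ᵇ x)
inversions-swap-head x y zs
  rewrite length-filterᵇ-∷ (_<ᵇ x) y zs | length-filterᵇ-∷ (_<ᵇ y) x zs =
  exchange (ind (y <ᵇ x)) (ind (x <ᵇ y)) (length (filterᵇ (_<ᵇ x) zs)) (length (filterᵇ (_<ᵇ y) zs)) (inversions zs)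
  where
  exchange : ∀ a b c d e → a + c + (d + e) + b ≡ b + d + (c + e) + a
  exchange = solve-∀

-- Only the relative order of the two swapped entries changes.
inversions-swapAt : ∀ m v → suc m < length v →
  inversions v + ind (at v m <ᵇ at v (suc m)) ≡ inversions (swapAt (suc m) v) + ind (at v (suc m) <ᵇ at v m)
inversions-swapAt zero (x ∷ y ∷ zs) _ = inversions-swap-head x y zs
inversions-swapAt zero (x ∷ []) (s≤s ())
inversions-swapAt (suc m) (x ∷ v) (s≤s lt) = begin
  smaller v + inversions v + ind (at v m <ᵇ at v (suc m))      ≡⟨ +-assoc (smaller v) _ _ ⟩
  smaller v + (inversions v + ind (at v m <ᵇ at v (suc m)))    ≡⟨ cong₂ _+_ (length-filter-<ᵇ-↭ x (↭-sym (swapAt-↭ (suc m) v)))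
                                                                             (inversions-swapAt m v lt) ⟩
  smaller v′ + (inversions v′ + ind (at v (suc m) <ᵇ at v m))  ≡⟨ +-assoc (smaller v′) _ _ ⟨
  smaller v′ + inversions v′ + ind (at v (suc m) <ᵇ at v m)    ∎
  where
  open ≡-Reasoning
  v′ = swapAt (suc m) v
  smaller : List ℕ → ℕ
  smaller u = length (filterᵇ (_<ᵇ x) u)

inversions-swapAt-≤ : ∀ k v → inversions (swapAt k v) ≤ suc (inversions v)
inversions-swapAt-≤ zero v = n≤1+n _
inversions-swapAt-≤ (suc m) v with suc m <? length v
... | no out = subst (λ u → inversions u ≤ suc (inversions v)) (sym (swapAt-out-of-range m v (≮⇒≥ out))) (n≤1+n _)
... | yes lt = begin
  inversions (swapAt (suc m) v)                                 ≤⟨ m≤m+n _ _ ⟩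
  inversions (swapAt (suc m) v) + ind (at v (suc m) <ᵇ at v m)  ≡⟨ inversions-swapAt m v lt ⟨
  inversions v + ind (at v m <ᵇ at v (suc m))                   ≤⟨ +-monoʳ-≤ (inversions v) (ind≤1 _) ⟩
  inversions v + 1                                              ≡⟨ +-comm (inversions v) 1 ⟩
  suc (inversions v)                                            ∎
  where open ≤-Reasoning

inversions-swapAt-increasing⇒ascent : ∀ k v → inversions (swapAt k v) ≡ suc (inversions v) →
  ∃[ m ] k ≡ suc m × suc m < length v × at v m < at v (suc m)
inversions-swapAt-increasing⇒ascent zero v inc = contradiction (sym inc) 1+n≢n
inversions-swapAt-increasing⇒ascent (suc m) v inc with suc m <? length v
... | no out = contradiction (trans (cong inversions (sym (swapAt-out-of-range m v (≮⇒≥ out)))) inc) (1+n≢n ∘ sym)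
... | yes lt = m , refl , lt , <ᵇ⇒< _ _ (ind-positive (+-cancelˡ-≤ (inversions v) 1 _ inv+1≤))
  where
  open ≤-Reasoning
  inv+1≤ : inversions v + 1 ≤ inversions v + ind (at v m <ᵇ at v (suc m))
  inv+1≤ = begin
    inversions v + 1                                              ≡⟨ +-comm (inversions v) 1 ⟩
    suc (inversions v)                                            ≡⟨ inc ⟨
    inversions (swapAt (suc m) v)                                 ≤⟨ m≤m+n _ _ ⟩
    inversions (swapAt (suc m) v) + ind (at v (suc m) <ᵇ at v m)  ≡⟨ inversions-swapAt m v lt ⟨
    inversions v + ind (at v m <ᵇ at v (suc m))                   ∎

inversions-swapAt-descent : ∀ m v → suc m < length v → at v (suc m) < at v m →
  inversions v ≡ suc (inversions (swapAt (suc m) v))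
inversions-swapAt-descent m v lt descent = begin
  inversions v                                                  ≡⟨ +-identityʳ _ ⟨
  inversions v + 0                                              ≡⟨ cong (inversions v +_) ascent-absent ⟨
  inversions v + ind (at v m <ᵇ at v (suc m))                   ≡⟨ inversions-swapAt m v lt ⟩
  inversions (swapAt (suc m) v) + ind (at v (suc m) <ᵇ at v m)  ≡⟨ cong (inversions (swapAt (suc m) v) +_) descent-present ⟩
  inversions (swapAt (suc m) v) + 1                             ≡⟨ +-comm _ 1 ⟩
  suc (inversions (swapAt (suc m) v))                           ∎
  where
  open ≡-Reasoning
  ascent-absent : ind (at v m <ᵇ at v (suc m)) ≡ 0
  ascent-absent = ind-false (<⇒≯ descent ∘ <ᵇ⇒< _ _)
  descent-present : ind (at v (suc m) <ᵇ at v m) ≡ 1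
  descent-present = ind-true (<⇒<ᵇ descent)

inversions-applyWord-≤ : ∀ v σ → inversions (applyWord v σ) ≤ inversions v + length σ
inversions-applyWord-≤ v [] = ≤-reflexive (sym (+-identityʳ _))
inversions-applyWord-≤ v (k ∷ σ) = begin
  inversions (applyWord (swapAt k v) σ)  ≤⟨ inversions-applyWord-≤ (swapAt k v) σ ⟩
  inversions (swapAt k v) + length σ     ≤⟨ +-monoˡ-≤ (length σ) (inversions-swapAt-≤ k v) ⟩
  suc (inversions v) + length σ          ≡⟨ +-suc (inversions v) (length σ) ⟨
  inversions v + length (k ∷ σ)          ∎
  where open ≤-Reasoning

-- As no letter adds more than one inversion, every letter of σ adds exactly one.
Increasing : List ℕ → List ℕ → Set
Increasing v σ = inversions (applyWord v σ) ≡ inversions v + length σ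

Increasing-∷ : ∀ v k σ → Increasing v (k ∷ σ) →
  inversions (swapAt k v) ≡ suc (inversions v) × Increasing (swapAt k v) σ
Increasing-∷ v k σ inc =
  ≤-antisym (inversions-swapAt-≤ k v) first≥ , ≤-antisym (inversions-applyWord-≤ (swapAt k v) σ) rest≥
  where
  open ≤-Reasoning
  first≥ : suc (inversions v) ≤ inversions (swapAt k v)
  first≥ = +-cancelʳ-≤ (length σ) _ _ (begin
    suc (inversions v) + length σ          ≡⟨ +-suc (inversions v) (length σ) ⟨
    inversions v + suc (length σ)          ≡⟨ inc ⟨
    inversions (applyWord (swapAt k v) σ)  ≤⟨ inversions-applyWord-≤ (swapAt k v) σ ⟩
    inversions (swapAt k v) + length σ     ∎)
  rest≥ : inversions (swapAt k v) + length σ ≤ inversions (applyWord (swapAt k v) σ)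
  rest≥ = begin
    inversions (swapAt k v) + length σ     ≤⟨ +-monoˡ-≤ (length σ) (inversions-swapAt-≤ k v) ⟩
    suc (inversions v) + length σ          ≡⟨ +-suc (inversions v) (length σ) ⟨
    inversions v + suc (length σ)          ≡⟨ inc ⟨
    inversions (applyWord (swapAt k v) σ)  ∎

Increasing-++ : ∀ v α β → Increasing v (α ++ β) → Increasing (applyWord v α) β
Increasing-++ v [] β inc = inc
Increasing-++ v (k ∷ α) β inc = Increasing-++ (swapAt k v) α β (proj₂ (Increasing-∷ v k (α ++ β) inc))

descent-or-sorted : ∀ v → (∃[ m ] suc m < length v × at v (suc m) < at v m) ⊎ Linked _≤_ v
descent-or-sorted [] = inj₂ []
descent-or-sorted (x ∷ []) = inj₂ [-]
descent-or-sorted (x ∷ y ∷ v) with y <? x | descent-or-sorted (y ∷ v)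
... | yes y<x | _ = inj₁ (0 , s≤s (s≤s z≤n) , y<x)
... | no _ | inj₁ (m , lt , descent) = inj₁ (suc m , s≤s lt , descent)
... | no y≮x | inj₂ sorted = inj₂ (≮⇒≥ y≮x ∷ sorted)

inversions-sorted : ∀ {v} → Linked _≤_ v → inversions v ≡ 0
inversions-sorted [] = refl
inversions-sorted [-] = refl
inversions-sorted {x ∷ v} (x≤y ∷ sorted) =
  cong₂ _+_ (cong length (filter-none (T? ∘ (_<ᵇ x)) none-smaller)) (inversions-sorted sorted)
  where
  none-smaller : All (λ z → ¬ T (z <ᵇ x)) v
  none-smaller = All.map (λ x≤z → ≤⇒≯ x≤z ∘ <ᵇ⇒< _ _) (Linked.Linked⇒All ≤-trans x≤y sorted)

inversions-identity : ∀ n → inversions (identity n) ≡ 0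
inversions-identity n = inversions-sorted (identity-sorted n)

sorted-perm-identity : ∀ {n v} → IsPerm n v → Linked _≤_ v → v ≡ identity n
sorted-perm-identity {n} v-perm sorted =
  Pointwise-≡⇒≡ (↗↭↗⇒≋ ≤-totalOrder sorted (identity-sorted n) (↭⇒↭ₛ v-perm))

ValidLetters-++ : ∀ {n α β} → ValidLetters n α → ValidLetters n β → ValidLetters n (α ++ β)
ValidLetters-++ [] β-valid = β-valid
ValidLetters-++ (k-valid ∷ α-valid) β-valid = k-valid ∷ ValidLetters-++ α-valid β-valid

InversionWord : ℕ → List ℕ → List ℕ → Set
InversionWord n v σ = ValidLetters n σ × wordProd n σ ≡ v × length σ ≡ inversions v

InversionWord-snoc : ∀ {n m v σ} → IsPerm n v → suc m < length v → at v (suc m) < at v m →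
  InversionWord n (swapAt (suc m) v) σ → InversionWord n v (σ ++ [ suc m ])
InversionWord-snoc {n} {m} {v} {σ} v-perm lt descent (σ-valid , σ-prod , σ-length) =
  ValidLetters-++ σ-valid ((s≤s z≤n , subst (suc m <_) (perm-length v-perm) lt) ∷ []) , prod , len
  where
  open ≡-Reasoning
  prod : wordProd n (σ ++ [ suc m ]) ≡ v
  prod = begin
    wordProd n (σ ++ [ suc m ])          ≡⟨ foldl-++ _ (identity n) σ [ suc m ] ⟩
    swapAt (suc m) (wordProd n σ)        ≡⟨ cong (swapAt (suc m)) σ-prod ⟩
    swapAt (suc m) (swapAt (suc m) v)    ≡⟨ swapAt-involutive (suc m) v ⟩
    v                                    ∎
  len : length (σ ++ [ suc m ]) ≡ inversions v
  len = begin
    length (σ ++ [ suc m ])              ≡⟨ length-++ σ ⟩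
    length σ + 1                         ≡⟨ +-comm (length σ) 1 ⟩
    suc (length σ)                       ≡⟨ cong suc σ-length ⟩
    suc (inversions (swapAt (suc m) v))  ≡⟨ inversions-swapAt-descent m v lt descent ⟨
    inversions v                         ∎

-- Bubble sort, recorded backwards.
inversionWord : ∀ n v → IsPerm n v → ∃[ σ ] InversionWord n v σ
inversionWord n v v-perm = go (inversions v) v v-perm refl
  where
  go : ∀ c v → IsPerm n v → inversions v ≡ c → ∃[ σ ] InversionWord n v σ
  go c v v-perm v-inv with descent-or-sorted v
  ... | inj₂ sorted = [] , [] , sym (sorted-perm-identity v-perm sorted) , sym (inversions-sorted sorted)
  go zero v _ v-inv | inj₁ (m , lt , descent) =
    contradiction (trans (sym v-inv) (inversions-swapAt-descent m v lt descent)) 0≢1+n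
  go (suc c) v v-perm v-inv | inj₁ (m , lt , descent) =
    Product.map (_++ [ suc m ]) (InversionWord-snoc v-perm lt descent)
      (go c (swapAt (suc m) v) (↭-trans (swapAt-↭ (suc m) v) v-perm)
        (suc-injective (trans (sym (inversions-swapAt-descent m v lt descent)) v-inv)))

reduced-increasing : ∀ {n u ρ} → IsReducedWord n u ρ → Increasing (identity n) ρ
reduced-increasing {n} {u} {ρ} (ρ-valid , ρ-prod , ρ-minimal) = begin
  inversions (applyWord (identity n) ρ)  ≡⟨ ≤-antisym upper lower ⟩
  length ρ                               ≡⟨ cong (_+ length ρ) (inversions-identity n) ⟨
  inversions (identity n) + length ρ     ∎
  where
  open ≡-Reasoning
  upper : inversions (applyWord (identity n) ρ) ≤ length ρ
  upper = subst (λ c → inversions (applyWord (identity n) ρ) ≤ c + length ρ) (inversions-identity n)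
                (inversions-applyWord-≤ (identity n) ρ)
  lower : length ρ ≤ inversions (applyWord (identity n) ρ)
  lower with inversionWord n u (subst (_↭ identity n) ρ-prod (applyWord-↭ (identity n) ρ))
  ... | σ , σ-valid , σ-prod , σ-length =
    subst (length ρ ≤_) (trans σ-length (cong inversions (sym ρ-prod))) (ρ-minimal σ σ-valid σ-prod)

InversionAcross : ℕ → List ℕ → Set
InversionAcross k v = ∃[ i ] ∃[ j ] i < k × k ≤ j × j < length v × at v j < at v i

module _ (m : ℕ) (v : List ℕ) (ascent : at v m < at v (suc m)) where

  private
    m+1< : suc m < length v
    m+1< = ascent-in-range m v ascent

  swapAt-ascent-leftward : ∀ x → ∃[ x′ ] x′ ≤ x × at v x ≤ at (swapAt (suc m) v) x′
  swapAt-ascent-leftward x with x ≟ m | x ≟ suc m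
  ... | yes refl | _ = m , ≤-refl , subst (at v m ≤_) (sym (at-swapAt-left m v m+1<)) (<⇒≤ ascent)
  ... | no _ | yes refl = m , n≤1+n m , ≤-reflexive (sym (at-swapAt-left m v m+1<))
  ... | no x≢m | no x≢m+1 = x , ≤-refl , ≤-reflexive (sym (at-swapAt-other m v x x≢m x≢m+1))

  swapAt-ascent-rightward : ∀ x → x < length v → ∃[ x′ ] x ≤ x′ × x′ < length v × at (swapAt (suc m) v) x′ ≤ at v x
  swapAt-ascent-rightward x x< with x ≟ m | x ≟ suc m
  ... | yes refl | _ = suc m , n≤1+n m , m+1< , ≤-reflexive (at-swapAt-right m v m+1<)
  ... | no _ | yes refl = suc m , ≤-refl , m+1< , subst (_≤ at v (suc m)) (sym (at-swapAt-right m v m+1<)) (<⇒≤ ascent)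
  ... | no x≢m | no x≢m+1 = x , ≤-refl , x< , ≤-reflexive (at-swapAt-other m v x x≢m x≢m+1)

  InversionAcross-swapAt-ascent : ∀ k → InversionAcross k v → InversionAcross k (swapAt (suc m) v)
  InversionAcross-swapAt-ascent k (i , j , i<k , k≤j , j< , v[j]<v[i])
    with swapAt-ascent-leftward i | swapAt-ascent-rightward j j<
  ... | i′ , i′≤i , v[i]≤ | j′ , j≤j′ , j′< , ≤v[j] =
    i′ , j′ , ≤-<-trans i′≤i i<k , ≤-trans k≤j j≤j′ , subst (j′ <_) (sym (length-swapAt (suc m) v)) j′< ,
    ≤-<-trans ≤v[j] (<-≤-trans v[j]<v[i] v[i]≤)

InversionAcross-swapAt-increasing : ∀ k v → inversions (swapAt k v) ≡ suc (inversions v) → InversionAcross k (swapAt k v)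
InversionAcross-swapAt-increasing k v inc with inversions-swapAt-increasing⇒ascent k v inc
... | m , refl , lt , ascent =
  m , suc m , ≤-refl , ≤-refl , subst (suc m <_) (sym (length-swapAt (suc m) v)) lt ,
  subst₂ _<_ (sym (at-swapAt-right m v lt)) (sym (at-swapAt-left m v lt)) ascent

InversionAcross-applyWord : ∀ k v σ → Increasing v σ → InversionAcross k v → InversionAcross k (applyWord v σ)
InversionAcross-applyWord k v [] _ inv = inv
InversionAcross-applyWord k v (k′ ∷ σ) inc inv with Increasing-∷ v k′ σ inc
... | step , rest with inversions-swapAt-increasing⇒ascent k′ v step
...   | m , refl , _ , ascent =
  InversionAcross-applyWord k (swapAt k′ v) σ rest (InversionAcross-swapAt-ascent m v ascent k inv)

inSupp⇒∈ : ∀ k ρ → T (inSupp k ρ) → k ∈ ρ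
inSupp⇒∈ k ρ k∈supp = Any.map (λ {a} → sym ∘ ≡ᵇ⇒≡ a k) (any⁻ (_≡ᵇ k) ρ k∈supp)

reduced-support-inversion : ∀ {n u ρ k} → IsReducedWord n u ρ → T (inSupp k ρ) → InversionAcross k u
reduced-support-inversion {n} {u} {ρ} {k} ρ-reduced k∈supp with ∈-∃++ (inSupp⇒∈ k ρ k∈supp)
... | α , β , refl = subst (InversionAcross k) u≡
  (InversionAcross-applyWord k (swapAt k v) β (proj₂ steps) (InversionAcross-swapAt-increasing k v (proj₁ steps)))
  where
  v : List ℕ
  v = applyWord (identity n) α
  steps : inversions (swapAt k v) ≡ suc (inversions v) × Increasing (swapAt k v) β
  steps = Increasing-∷ v k β (Increasing-++ (identity n) α (k ∷ β) (reduced-increasing ρ-reduced))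
  u≡ : applyWord (swapAt k v) β ≡ u
  u≡ = trans (sym (foldl-++ _ (identity n) α (k ∷ β))) (proj₁ (proj₂ ρ-reduced))

-- Deleting the letter N

module _ (N : ℕ) where

  deleteLetter-absent : ∀ w → (∀ x → at w x ≢ N) → deleteLetter N w ≡ w
  deleteLetter-absent [] _ = refl
  deleteLetter-absent (y ∷ w) absent =
    trans (filter-accept (λ x → ¬? (x ≟ N)) (absent 0)) (cong (y ∷_) (deleteLetter-absent w (absent ∘ suc)))

  deleteLetter-∷-≢ : ∀ {y} w → y ≢ N → deleteLetter N (y ∷ w) ≡ y ∷ deleteLetter N w
  deleteLetter-∷-≢ w = filter-accept (λ x → ¬? (x ≟ N))

  at-deleteLetter-< : ∀ w p → (∀ {x} → x ≢ p → at w x ≢ N) → ∀ x → x < p → at (deleteLetter N w) x ≡ at w x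
  at-deleteLetter-< [] p _ x _ = refl
  at-deleteLetter-< (y ∷ w) (suc p) only-p zero _ = cong (λ v → at v 0) (deleteLetter-∷-≢ w (only-p {0} (λ ())))
  at-deleteLetter-< (y ∷ w) (suc p) only-p (suc x) (s≤s x<p) =
    trans (cong (λ v → at v (suc x)) (deleteLetter-∷-≢ w (only-p {0} (λ ()))))
          (at-deleteLetter-< w p (λ x≢p → only-p (x≢p ∘ suc-injective)) x x<p)

  at-deleteLetter-≥ : ∀ w p → at w p ≡ N → (∀ {x} → x ≢ p → at w x ≢ N) →
    ∀ x → p ≤ x → at (deleteLetter N w) x ≡ at w (suc x)
  at-deleteLetter-≥ [] p _ _ x _ = refl
  at-deleteLetter-≥ (y ∷ w) zero y≡N only-p x _ =
    cong (λ v → at v x) (trans (filter-reject (λ x → ¬? (x ≟ N)) (λ y≢N → y≢N y≡N))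
                               (deleteLetter-absent w (λ x → only-p {suc x} (λ ()))))
  at-deleteLetter-≥ (y ∷ w) (suc p) w[p]≡N only-p (suc x) (s≤s p≤x) =
    trans (cong (λ v → at v (suc x)) (deleteLetter-∷-≢ w (only-p {0} (λ ()))))
          (at-deleteLetter-≥ w p w[p]≡N (λ x≢p → only-p (x≢p ∘ suc-injective)) x p≤x)

-- Counting occurrences of 321 and 3412

module Occurrences (N : ℕ) (w : List ℕ) where

  Occurrence : Set
  Occurrence = (ℕ × ℕ × ℕ) ⊎ (ℕ × ℕ × ℕ × ℕ)

  IsOccurrence : Occurrence → Set
  IsOccurrence (inj₁ (i , j , k)) =
    i < j × j < k × k < N × at w j < at w i × at w k < at w j × at w i ≡ N
  IsOccurrence (inj₂ (a , b , c , d)) =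
    a < b × b < c × c < d × d < N × at w c < at w d × at w d < at w a × at w a < at w b × at w b ≡ N

  private
    positions : List ℕ
    positions = upTo N

    is321 : ℕ → ℕ → ℕ → Bool
    is321 i j k = (i <ᵇ j) ∧ (j <ᵇ k) ∧ (at w j <ᵇ at w i) ∧ (at w k <ᵇ at w j) ∧ (at w i ≡ᵇ N)

    is3412 : ℕ → ℕ → ℕ → ℕ → Bool
    is3412 a b c d = (a <ᵇ b) ∧ (b <ᵇ c) ∧ (c <ᵇ d)
      ∧ (at w c <ᵇ at w d) ∧ (at w d <ᵇ at w a) ∧ (at w a <ᵇ at w b) ∧ (at w b ≡ᵇ N)

    occurrences321 : List (ℕ × ℕ × ℕ)
    occurrences321 = concatMap (λ i → concatMap (λ j →
      map (λ k → i , j , k) (filterᵇ (is321 i j) positions)) positions) positions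

    occurrences3412 : List (ℕ × ℕ × ℕ × ℕ)
    occurrences3412 = concatMap (λ a → concatMap (λ b → concatMap (λ c →
      map (λ d → a , b , c , d) (filterᵇ (is3412 a b c) positions)) positions) positions) positions

    length-map-filterᵇ : ∀ (f : ℕ → A) b → length (map f (filterᵇ b positions)) ≡ sum (map (λ x → ind (b x)) positions)
    length-map-filterᵇ f b = trans (length-map f (filterᵇ b positions)) (sym (sum-ind≡length-filterᵇ b positions))

    length-concatMap-positions : ∀ (f : ℕ → List A) {g} → (∀ x → length (f x) ≡ g x) →
      length (concatMap f positions) ≡ sum (map g positions)
    length-concatMap-positions f eq = trans (length-concatMap f positions) (cong sum (map-cong eq positions))

    ∈-positions-filterᵇ : ∀ {x} b → x < N → T (b x) → x ∈ filterᵇ b positions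
    ∈-positions-filterᵇ b x<N bx = ∈-filter⁺ (T? ∘ b) (∈-upTo⁺ x<N) bx

  occurrences : List Occurrence
  occurrences = map inj₁ occurrences321 ++ map inj₂ occurrences3412

  length-occurrences : length occurrences ≡ count321-3412N N w
  length-occurrences = begin
    length occurrences                                                    ≡⟨ length-++ (map inj₁ occurrences321) ⟩
    length (map inj₁ occurrences321) + length (map inj₂ occurrences3412)  ≡⟨ cong₂ _+_ (length-map inj₁ occurrences321)
                                                                                       (length-map inj₂ occurrences3412) ⟩
    length occurrences321 + length occurrences3412                        ≡⟨ cong₂ _+_ length321 length3412 ⟩
    count321-3412N N w                                                    ∎
    where
    open ≡-Reasoning
    length321 : length occurrences321 ≡ count321N N w
    length321 = length-concatMap-positions _ λ i → length-concatMap-positions _ λ j →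
      length-map-filterᵇ (λ k → i , j , k) (is321 i j)
    length3412 : length occurrences3412 ≡ count3412N N w
    length3412 = length-concatMap-positions _ λ a → length-concatMap-positions _ λ b →
      length-concatMap-positions _ λ c → length-map-filterᵇ (λ d → a , b , c , d) (is3412 a b c)

  IsOccurrence⇒∈ : ∀ t → IsOccurrence t → t ∈ occurrences
  IsOccurrence⇒∈ (inj₁ (i , j , k)) (i<j , j<k , k<N , w[j]<w[i] , w[k]<w[j] , w[i]≡N) =
    ∈-++⁺ˡ (∈-map⁺ inj₁ (∈-concatMap⁺ _ (∈-upTo⁺ i<N) (∈-concatMap⁺ _ (∈-upTo⁺ j<N)
      (∈-map⁺ (λ k → i , j , k) (∈-positions-filterᵇ (is321 i j) k<N
        (<⇒<ᵇ i<j ∧ᵀ <⇒<ᵇ j<k ∧ᵀ <⇒<ᵇ w[j]<w[i] ∧ᵀ <⇒<ᵇ w[k]<w[j] ∧ᵀ ≡⇒≡ᵇ _ _ w[i]≡N))))))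
    where
    j<N = <-trans j<k k<N
    i<N = <-trans i<j j<N
  IsOccurrence⇒∈ (inj₂ (a , b , c , d)) (a<b , b<c , c<d , d<N , w[c]<w[d] , w[d]<w[a] , w[a]<w[b] , w[b]≡N) =
    ∈-++⁺ʳ (map inj₁ occurrences321) (∈-map⁺ inj₂ (∈-concatMap⁺ _ (∈-upTo⁺ a<N) (∈-concatMap⁺ _ (∈-upTo⁺ b<N)
      (∈-concatMap⁺ _ (∈-upTo⁺ c<N) (∈-map⁺ (λ d → a , b , c , d) (∈-positions-filterᵇ (is3412 a b c) d<N
        (<⇒<ᵇ a<b ∧ᵀ <⇒<ᵇ b<c ∧ᵀ <⇒<ᵇ c<d ∧ᵀ <⇒<ᵇ w[c]<w[d] ∧ᵀ <⇒<ᵇ w[d]<w[a] ∧ᵀ <⇒<ᵇ w[a]<w[b] ∧ᵀ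
         ≡⇒≡ᵇ _ _ w[b]≡N)))))))
    where
    c<N = <-trans c<d d<N
    b<N = <-trans b<c c<N
    a<N = <-trans a<b b<N

-- The injection

data LastBelow (P : ℕ → Set) (n : ℕ) : Set where
  found : ∀ c → c < n → P c → (∀ {c′} → c < c′ → c′ < n → ¬ P c′) → LastBelow P n
  none  : (∀ {c} → c < n → ¬ P c) → LastBelow P n

lastBelow : ∀ {P : ℕ → Set} → Decidable P → ∀ n → LastBelow P n
lastBelow P? zero = none (λ ())
lastBelow {P} P? (suc n) with P? n | lastBelow P? n
... | yes Pn | _ = found n ≤-refl Pn (λ n<c′ c′≤n → contradiction (≤-pred c′≤n) (<⇒≱ n<c′))
... | no ¬Pn | found c c<n Pc after =
  found c (m<n⇒m<1+n c<n) Pc (λ c<c′ c′≤n → [ after c<c′ , ¬P-n ]′ (m<1+n⇒m<n∨m≡n c′≤n))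
  where
  ¬P-n : ∀ {c′} → c′ ≡ n → ¬ P c′
  ¬P-n refl = ¬Pn
... | no ¬Pn | none absent = none (λ c≤n → [ absent , ¬P-n ]′ (m<1+n⇒m<n∨m≡n c≤n))
  where
  ¬P-n : ∀ {c} → c ≡ n → ¬ P c
  ¬P-n refl = ¬Pn

module Injection (N : ℕ) (w : List ℕ) (w-perm : IsPerm N w) (p : ℕ) (p<N : p < N) (w[p]≡N : at w p ≡ N) where

  open Occurrences N w

  InversionOver : ℕ → Set
  InversionOver k = p < k × ∃[ i ] ∃[ j ] i ≤ k × i ≢ p × k < j × j < N × at w j < at w i

  InversionOver⇒1+k<N : ∀ {k} → InversionOver k → suc k < N
  InversionOver⇒1+k<N (_ , _ , _ , _ , _ , k<j , j<N , _) = <-≤-trans (s≤s k<j) j<N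

  positionsRight : ℕ → List ℕ
  positionsRight k = filter (k <?_) (upTo N)

  minRight : ℕ → ℕ
  minRight k = argmin ≤-totalOrder (at w) (suc k) (positionsRight k)

  k<minRight : ∀ k → k < minRight k
  k<minRight k = argmin-all ≤-totalOrder (at w) ≤-refl (All.tabulate (proj₂ ∘ ∈-filter⁻ (k <?_) {xs = upTo N}))

  minRight<N : ∀ k → suc k < N → minRight k < N
  minRight<N k 1+k<N =
    argmin-all ≤-totalOrder (at w) 1+k<N (All.tabulate (∈-upTo⁻ ∘ proj₁ ∘ ∈-filter⁻ (k <?_) {xs = upTo N}))

  minRight-minimal : ∀ k j → k < j → j < N → at w (minRight k) ≤ at w j
  minRight-minimal k j k<j j<N =
    All.lookup (f[argmin]≤f[xs] ≤-totalOrder (suc k) (positionsRight k)) (∈-filter⁺ (k <?_) (∈-upTo⁺ j<N) k<j)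

  Exceeds : ℕ → ℕ → Set
  Exceeds k c = c ≢ p × at w (minRight k) < at w c

  Exceeds? : ∀ k → Decidable (Exceeds k)
  Exceeds? k c = ¬? (c ≟ p) ×-dec (at w (minRight k) <? at w c)

  ¬Exceeds⇒≤ : ∀ {k c} → c ≢ p → ¬ Exceeds k c → at w c ≤ at w (minRight k)
  ¬Exceeds⇒≤ c≢p ¬exceeds = ≮⇒≥ (λ lt → ¬exceeds (c≢p , lt))

  InversionOver⇒Exceeds : ∀ {k} → InversionOver k → ¬ (∀ {c} → c < suc k → ¬ Exceeds k c)
  InversionOver⇒Exceeds {k} (_ , i , j , i≤k , i≢p , k<j , j<N , w[j]<w[i]) absent =
    absent (s≤s i≤k) (i≢p , ≤-<-trans (minRight-minimal k j k<j j<N) w[j]<w[i])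

  lastExceeding : ∀ k → LastBelow (Exceeds k) (suc k)
  lastExceeding k = lastBelow (Exceeds? k) (suc k)

  occurrenceFrom : ∀ k → LastBelow (Exceeds k) (suc k) → Occurrence
  occurrenceFrom k (found c _ _ _) with c <? p
  ... | yes _ = inj₂ (c , p , k , minRight k)
  ... | no _ = inj₁ (p , c , minRight k)
  occurrenceFrom k (none _) = inj₁ (p , p , p)  -- junk: InversionOver k rules this case out

  occurrenceOf : ℕ → Occurrence
  occurrenceOf k = occurrenceFrom k (lastExceeding k)

  occurrenceFrom-valid : ∀ k r → InversionOver k → IsOccurrence (occurrenceFrom k r)
  occurrenceFrom-valid k (none absent) inv = ⊥-elim (InversionOver⇒Exceeds inv absent)
  occurrenceFrom-valid k (found c c≤k (c≢p , w[d]<w[c]) after) inv with c <? p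
  ... | yes c<p = c<p , p<k , k<minRight k , d<N , w[k]<w[d] , w[d]<w[c] , w[c]<w[p] , w[p]≡N
    where
    p<k = proj₁ inv
    d<N = minRight<N k (InversionOver⇒1+k<N inv)
    w[k]<w[d] : at w k < at w (minRight k)
    w[k]<w[d] = ≤∧≢⇒< (¬Exceeds⇒≤ (≢-sym (<⇒≢ p<k)) (after (<-trans c<p p<k) ≤-refl))
      (<⇒≢ (k<minRight k) ∘ perm-at-injective w-perm (<-trans (n<1+n k) (InversionOver⇒1+k<N inv)) d<N)
    w[c]<w[p] = subst (at w c <_) (sym w[p]≡N) (perm-at-<-max w-perm p<N w[p]≡N c≢p)
  ... | no c≮p = ≤∧≢⇒< (≮⇒≥ c≮p) (≢-sym c≢p) , <-≤-trans c≤k (k<minRight k) ,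
    minRight<N k (InversionOver⇒1+k<N inv) , w[c]<w[p] , w[d]<w[c] , w[p]≡N
    where
    w[c]<w[p] = subst (at w c <_) (sym w[p]≡N) (perm-at-<-max w-perm p<N w[p]≡N c≢p)

  -- As c < k′ ≢ p, k′ is not exceeding, so w(k′) ≤ w(d); and k′ lies right of k, so w(d) ≤ w(k′).
  minRight-shared⇒⊥ : ∀ {k k′ c c′} → k < k′ → InversionOver k′ → c < suc k →
    (∀ {x} → c′ < x → x < suc k′ → ¬ Exceeds k′ x) → c ≡ c′ → minRight k ≡ minRight k′ → ⊥
  minRight-shared⇒⊥ {k} {k′} k<k′ inv′ c≤k after c≡c′ d≡d′ =
    <⇒≢ (k<minRight k′) (perm-at-injective w-perm k′<N (minRight<N k′ (InversionOver⇒1+k<N inv′))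
      (≤-antisym w[k′]≤w[d′] w[d′]≤w[k′]))
    where
    k′<N = <-trans (n<1+n k′) (InversionOver⇒1+k<N inv′)
    w[k′]≤w[d′] : at w k′ ≤ at w (minRight k′)
    w[k′]≤w[d′] = ¬Exceeds⇒≤ (≢-sym (<⇒≢ (proj₁ inv′))) (after (subst (_< k′) c≡c′ (<-≤-trans c≤k k<k′)) ≤-refl)
    w[d′]≤w[k′] : at w (minRight k′) ≤ at w k′
    w[d′]≤w[k′] = subst (λ d → at w d ≤ at w k′) d≡d′ (minRight-minimal k k′ k<k′ k′<N)

  occurrenceFrom-injective : ∀ k k′ r r′ → InversionOver k → InversionOver k′ →
    occurrenceFrom k r ≡ occurrenceFrom k′ r′ → k ≡ k′
  occurrenceFrom-injective k k′ (none absent) r′ inv _ _ = ⊥-elim (InversionOver⇒Exceeds inv absent)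
  occurrenceFrom-injective k k′ r (none absent) _ inv′ _ = ⊥-elim (InversionOver⇒Exceeds inv′ absent)
  occurrenceFrom-injective k k′ (found c c≤k _ after) (found c′ c′≤k′ _ after′) inv inv′ eq
    with c <? p | c′ <? p
  ... | yes _ | yes _ = cong (proj₁ ∘ proj₂ ∘ proj₂) (inj₂-injective eq)
  ... | yes _ | no _ = contradiction eq λ ()
  ... | no _ | yes _ = contradiction eq λ ()
  ... | no _ | no _ = by-cases (<-cmp k k′)
    where
    c≡c′ = cong (proj₁ ∘ proj₂) (inj₁-injective eq)
    d≡d′ = cong (proj₂ ∘ proj₂) (inj₁-injective eq)
    by-cases : Tri (k < k′) (k ≡ k′) (k′ < k) → k ≡ k′
    by-cases (tri≈ _ k≡k′ _) = k≡k′
    by-cases (tri< k<k′ _ _) = ⊥-elim (minRight-shared⇒⊥ k<k′ inv′ c≤k after′ c≡c′ d≡d′)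
    by-cases (tri> _ _ k′<k) = ⊥-elim (minRight-shared⇒⊥ k′<k inv c′≤k′ after (sym c≡c′) (sym d≡d′))

  -- The last entry of a 321 in the image is the minimum of everything to its right.
  occurrenceFrom-≢-extendable : ∀ k r → InversionOver k → ∀ {a b c d} → c < d → d < N → at w d < at w c →
    occurrenceFrom k r ≢ inj₁ (a , b , c)
  occurrenceFrom-≢-extendable k (none absent) inv _ _ _ _ = InversionOver⇒Exceeds inv absent
  occurrenceFrom-≢-extendable k (found c′ _ _ _) inv {d = d} c<d d<N w[d]<w[c] eq with c′ <? p
  ... | yes _ = contradiction eq λ ()
  ... | no _ = <⇒≱ w[d]<w[c] (subst (λ x → at w x ≤ at w d) d≡c
      (minRight-minimal k d (<-trans (subst (k <_) d≡c (k<minRight k)) c<d) d<N))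
    where
    d≡c = cong (proj₂ ∘ proj₂) (inj₁-injective eq)

  private
    other-positions : ∀ {x} → x ≢ p → at w x ≢ N
    other-positions x≢p = <⇒≢ (perm-at-<-max w-perm p<N w[p]≡N x≢p)

  length-deleteLetter : length (deleteLetter N w) < N
  length-deleteLetter = subst (length (deleteLetter N w) <_) (perm-length w-perm)
    (filter-notAll (λ x → ¬? (x ≟ N)) w (Any.map (λ N≡x x≢N → x≢N (sym N≡x)) N∈w))
    where
    N∈w : N ∈ w
    N∈w = subst (_∈ w) w[p]≡N (at-∈ w (subst (p <_) (sym (perm-length w-perm)) p<N))

  InversionAcross-deleteLetter : ∀ {k} → p < k → InversionAcross k (deleteLetter N w) → InversionOver k
  InversionAcross-deleteLetter {k} p<k (i , j , i<k , k≤j , j< , u[j]<u[i]) = p<k , lift (i <? p)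
    where
    u = deleteLetter N w
    1+j<N : suc j < N
    1+j<N = ≤-trans (s≤s j<) length-deleteLetter
    w[1+j]<u[i] : at w (suc j) < at u i
    w[1+j]<u[i] = subst (_< at u i) (at-deleteLetter-≥ N w p w[p]≡N other-positions j (≤-trans (<⇒≤ p<k) k≤j)) u[j]<u[i]
    lift : Dec (i < p) → ∃[ i′ ] ∃[ j′ ] i′ ≤ k × i′ ≢ p × k < j′ × j′ < N × at w j′ < at w i′
    lift (yes i<p) = i , suc j , <⇒≤ i<k , <⇒≢ i<p , s≤s k≤j , 1+j<N ,
      subst (at w (suc j) <_) (at-deleteLetter-< N w p other-positions i i<p) w[1+j]<u[i]
    lift (no i≮p) = suc i , suc j , i<k , (λ 1+i≡p → i≮p (subst (i <_) 1+i≡p (n<1+n i))) , s≤s k≤j , 1+j<N ,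
      subst (at w (suc j) <_) (at-deleteLetter-≥ N w p w[p]≡N other-positions i (≮⇒≥ i≮p)) w[1+j]<u[i]

  length<count321-3412 : Has4321N N w → ∀ {K} → Unique K → (∀ {k} → k ∈ K → InversionOver k) →
    length K < count321-3412N N w
  length<count321-3412 (a , b , c , d , a<b , b<c , c<d , d<N , w[b]<w[a] , w[c]<w[b] , w[d]<w[c] , w[a]≡N) {K} K-unique K-inv =
    begin-strict
      length K                     ≡⟨ length-map occurrenceOf K ⟨
      length (map occurrenceOf K)  <⟨ Unique-⊆⇒length≤ images-unique images⊆occurrences ⟩
      length occurrences           ≡⟨ length-occurrences ⟩
      count321-3412N N w           ∎
    where
    open ≤-Reasoning
    images : List Occurrence
    images = inj₁ (a , b , c) ∷ map occurrenceOf K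
    injective : ∀ {k k′} → k ∈ K → k′ ∈ K → occurrenceOf k ≡ occurrenceOf k′ → k ≡ k′
    injective {k} {k′} k∈ k′∈ =
      occurrenceFrom-injective k k′ (lastExceeding k) (lastExceeding k′) (K-inv k∈) (K-inv k′∈)
    extendable∉ : ∀ {t} → t ∈ map occurrenceOf K → inj₁ (a , b , c) ≢ t
    extendable∉ t∈ eq with ∈-map⁻ occurrenceOf t∈
    ... | k , k∈ , refl = occurrenceFrom-≢-extendable k (lastExceeding k) (K-inv k∈) c<d d<N w[d]<w[c] (sym eq)
    images-unique : Unique images
    images-unique = All.tabulate extendable∉ ∷ Unique-map⁺-on occurrenceOf injective K-unique
    images⊆occurrences : images ⊆ occurrences
    images⊆occurrences (here refl) = IsOccurrence⇒∈ _ (a<b , b<c , <-trans c<d d<N , w[b]<w[a] , w[c]<w[b] , w[a]≡N)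
    images⊆occurrences (there t∈) with ∈-map⁻ occurrenceOf t∈
    ... | k , k∈ , refl = IsOccurrence⇒∈ (occurrenceOf k) (occurrenceFrom-valid k (lastExceeding k) (K-inv k∈))

corollary4p1p5 : (N : ℕ) (w : List ℕ) → IsPerm N w → Has4321N N w →
    (p : ℕ) → p < N → at w p ≡ N →
    (ρ : List ℕ) → IsReducedWord (N ∸ 1) (deleteLetter N w) ρ →
    newrepCount N (suc p) ρ < count321-3412N N w
corollary4p1p5 N w w-perm has4321 p p<N w[p]≡N ρ ρ-reduced = begin-strict
  newrepCount N (suc p) ρ  ≡⟨ sum-ind≡length-filterᵇ inNewrep (upTo N) ⟩
  length newrep            <⟨ length<count321-3412 has4321 (Unique.filter⁺ (T? ∘ inNewrep) (Unique.upTo⁺ N)) newrep-inversion ⟩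
  count321-3412N N w       ∎
  where
  open ≤-Reasoning
  open Injection N w w-perm p p<N w[p]≡N
  inNewrep : ℕ → Bool
  inNewrep k = inSupp k ρ ∧ (suc p ≤ᵇ k)
  newrep : List ℕ
  newrep = filterᵇ inNewrep (upTo N)
  newrep-inversion : ∀ {k} → k ∈ newrep → InversionOver k
  newrep-inversion {k} k∈ with Equivalence.to T-∧ (proj₂ (∈-filter⁻ (T? ∘ inNewrep) {xs = upTo N} k∈))
  ... | k∈supp , 1+p≤k = InversionAcross-deleteLetter (≤ᵇ⇒≤ _ _ 1+p≤k) (reduced-support-inversion ρ-reduced k∈supp)
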